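{- Let $\Delta$ be a connected, pure $(d-1)$-dimensional simplicial complex with $d\ge 4$ that is semi-Eulerian, and suppose $(\Delta,\phi)$ is a balanced complex of type $\mathbf{a}=(a_1,\dots,a_m)$. Then for every $\mathbf{b}\le \mathbf{a}$, $$h_{\mathbf{a}-\mathbf{b}}-h_{\mathbf{b}}=(-1)^{|\mathbf{b}|}\,\bigl[\chi(\Delta)-\chi(S^{d-1})\bigr]\prod_{j=1}^m\binom{a_j}{b_j}.$$
   Context: $\chi$ denotes the (unreduced) Euler characteristic, so $\chi(S^{d-1})=1+(-1)^{d-1}$. The link of a face $\rho$ is $\operatorname{lk}\rho=\{\tau\in\Delta:\tau\cap\rho=\emptyset,\ \tau\cup\rho\in\Delta\}$. $\Delta$ is semi-Eulerian if for every nonempty face $\rho$, $\chi(\operatorname{lk}\rho)=\chi(S^{d-|\rho|-1})$. Let $V$ be the vertex set, $\mathbf{a}=(a_1,\dots,a_m)$ positive integers with $|\mathbf{a}|=a_1+\dots+a_m=d$, and $\phi:V\to\{1,\dots,m\}$ surjective; $(\Delta,\phi)$ is balanced of type $\mathbf{a}$ if every facet $\sigma$ satisfies $|\sigma\cap\phi^{ -1}(j)|=a_j$ for all $j$. For integer vectors $\mathbf{b}=(b_1,\dots,b_m)$ write $\mathbf{b}\le\mathbf{a}$ if $0\le b_j\le a_j$ for all $j$; $|\mathbf{b}|=\sum b_j$ and $\mathbf{a}-\mathbf{b}=(a_1-b_1,\dots,a_m-b_m)$. For $\mathbf{b}\le\mathbf{a}$, $f_{\mathbf{b}}$ is the number of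 faces $\rho$ (including the empty face) with $|\rho\cap\phi^{ -1}(j)|=b_j$ for all $j$, and the fine $h$-vector is $h_{\mathbf{b}}=\sum_{\mathbf{c}\le\mathbf{b}} f_{\mathbf{c}}\prod_{i=1}^m(-1)^{b_i-c_i}\binom{a_i-c_i}{b_i-c_i}$. -}

module Defs where

open import Data.Bool using (T?; Bool; true; false; _∧_; if_then_else_)
open import Data.Nat as ℕ using (ℕ; zero; suc; _≤_; _∸_; _≡ᵇ_)
open import Data.Nat.Combinatorics using (_C_)
open import Data.Integer as ℤ using (ℤ; +_; -_)
open import Data.Fin using (Fin; zero; suc; _≟_)
open import Data.Fin.Subset using (Subset; ⁅_⁆; _⊆_; _∩_; _∪_; ∣_∣; ⊥)
open import Data.Vec using (Vec; []; _∷_; tabulate)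
open import Data.List using (List; []; _∷_; [_]; _++_; map; concatMap; filter; length; foldr; allFin; upTo)
open import Data.Product using (Σ; ∃; _×_; _,_)
open import Relation.Nullary.Decidable using (⌊_⌋)
open import Relation.Binary.PropositionalEquality using (_≡_)

subsets : ∀ n → List (Subset n)
subsets zero = [ [] ]
subsets (suc n) = concatMap (λ s → (false ∷ s) ∷ (true ∷ s) ∷ []) (subsets n)

sumℤ : List ℤ → ℤ
sumℤ = foldr ℤ._+_ (+ 0)

sumℕ : List ℕ → ℕ
sumℕ = foldr ℕ._+_ 0

sign : ℕ → ℤ
sign zero = + 1
sign (suc k) = - sign k

record SimplicialComplex (n : ℕ) : Set where
  field
    face      : Subset n → Bool
    emptyFace : face ⊥ ≡ true
    downClosed : ∀ {s t} → face s ≡ true → t ⊆ s → face t ≡ true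
    vertices  : ∀ v → face ⁅ v ⁆ ≡ true
open SimplicialComplex public

-- unreduced Euler characteristic of the complex whose faces are given by P:
-- sum over nonempty faces ρ of (-1)^(|ρ|-1)
eulerChar : ∀ {n} → (Subset n → Bool) → ℤ
eulerChar {n} P = sumℤ (map (λ s → if P s then term ∣ s ∣ else + 0) (subsets n))
  where
  term : ℕ → ℤ
  term zero = + 0
  term (suc k) = sign k

χ : ∀ {n} → SimplicialComplex n → ℤ
χ Δ = eulerChar (face Δ)

-- χ(S^(k-1)) = 1 + (-1)^(k-1) for k ≥ 1, and χ(S^(-1)) = χ(∅) = 0
χSphere : ℕ → ℤ
χSphere zero = + 0
χSphere (suc j) = + 1 ℤ.+ sign j

link : ∀ {n} → SimplicialComplex n → Subset n → (Subset n → Bool)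
link Δ ρ τ = (∣ τ ∩ ρ ∣ ≡ᵇ 0) ∧ face Δ (τ ∪ ρ)

IsFace : ∀ {n} → SimplicialComplex n → Subset n → Set
IsFace Δ s = face Δ s ≡ true

Pure : ∀ {n} → SimplicialComplex n → ℕ → Set
Pure Δ d = (∀ s → IsFace Δ s → ∣ s ∣ ≤ d)
         × (∀ s → IsFace Δ s → ∃ λ t → IsFace Δ t × s ⊆ t × ∣ t ∣ ≡ d)

data Walk {n} (Δ : SimplicialComplex n) : Fin n → Fin n → Set where
  here : ∀ {u} → Walk Δ u u
  step : ∀ {u w v} → IsFace Δ (⁅ u ⁆ ∪ ⁅ w ⁆) → Walk Δ w v → Walk Δ u v

Connected : ∀ {n} → SimplicialComplex n → Set
Connected {n} Δ = ∀ (u v : Fin n) → Walk Δ u v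

SemiEulerian : ∀ {n} → SimplicialComplex n → ℕ → Set
SemiEulerian {n} Δ d = ∀ (ρ : Subset n) → IsFace Δ ρ → 0 ℕ.< ∣ ρ ∣ →
  eulerChar (link Δ ρ) ≡ χSphere (d ∸ ∣ ρ ∣)

IsFacet : ∀ {n} → SimplicialComplex n → Subset n → Set
IsFacet Δ σ = IsFace Δ σ × (∀ t → IsFace Δ t → σ ⊆ t → t ≡ σ)

colorCount : ∀ {n m} → (Fin n → Fin m) → Subset n → Fin m → ℕ
colorCount φ ρ j = ∣ ρ ∩ tabulate (λ v → ⌊ φ v ≟ j ⌋) ∣

Surjective : ∀ {n m} → (Fin n → Fin m) → Set
Surjective {n} {m} φ = ∀ (j : Fin m) → ∃ λ (v : Fin n) → φ v ≡ j

Balanced : ∀ {n m} → SimplicialComplex n → (Fin n → Fin m) → (Fin m → ℕ) → Set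
Balanced {n} {m} Δ φ a = Surjective φ ×
  (∀ (σ : Subset n) → IsFacet Δ σ → ∀ (j : Fin m) → colorCount φ σ j ≡ a j)

_≤v_ : ∀ {m} → (Fin m → ℕ) → (Fin m → ℕ) → Set
_≤v_ {m} b a = ∀ (j : Fin m) → b j ≤ a j

∣_∣v : ∀ {m} → (Fin m → ℕ) → ℕ
∣_∣v {m} b = sumℕ (map b (allFin m))

box : ∀ m → (Fin m → ℕ) → List (Fin m → ℕ)
box zero b = [ (λ ()) ]
box (suc m) b = concatMap (λ i → map (cons i) (box m (λ j → b (suc j)))) (upTo (suc (b zero)))
  where
  cons : ℕ → (Fin m → ℕ) → (Fin (suc m) → ℕ)
  cons i c zero = i
  cons i c (suc j) = c j

prodℤ : ∀ m → (Fin m → ℤ) → ℤ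
prodℤ m g = foldr ℤ._*_ (+ 1) (map g (allFin m))

allEq : ∀ {m} → (Fin m → ℕ) → (Fin m → ℕ) → Bool
allEq {m} x y = foldr _∧_ true (map (λ j → x j ≡ᵇ y j) (allFin m))

fineF : ∀ {n m} → SimplicialComplex n → (Fin n → Fin m) → (Fin m → ℕ) → ℕ
fineF {n} Δ φ b = length (filter (λ ρ → T? (face Δ ρ ∧ allEq (colorCount φ ρ) b)) (subsets n))

fineH : ∀ {n m} → SimplicialComplex n → (Fin n → Fin m) → (a b : Fin m → ℕ) → ℤ
fineH {n} {m} Δ φ a b = sumℤ (map term (box m b))
  where
  term : (Fin m → ℕ) → ℤ
  term c = + fineF Δ φ c ℤ.* prodℤ m (λ i → sign (b i ∸ c i) ℤ.* + ((a i ∸ c i) C (b i ∸ c i)))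

-- Write h_b as a sum over the faces ρ of Δ of Π_j (-1)^(b_j - c_j) C(a_j - c_j, b_j - c_j), where
-- c = c(ρ) is the colour vector of ρ.  For a face σ, the reversal b ↦ a - b turns its term into
-- (-1)^(d - |σ|) Σ_{ρ ⊆ σ} (term of ρ at b), by Pascal's rule applied to one vertex of σ at a time.
-- Exchanging the two sums, each face ρ receives the weight E(ρ) = Σ_{σ ⊇ ρ} (-1)^(d - |σ|), which is
-- (-1)^(d - |ρ|) (1 - χ(lk ρ)) = 1 for ρ ≠ ∅ because Δ is semi-Eulerian.  Hence
-- h_{a-b} = h_b + (E(∅) - 1) (-1)^|b| Π_j C(a_j, b_j).  The same exchange applied to the weights
-- (-1)^|ρ|, whose sums over the subsets of σ vanish unless σ = ∅, gives E(∅) = χ(Δ) + (-1)^d,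
-- so E(∅) - 1 = χ(Δ) - χ(S^(d-1)).
module Submission where

open import Defs
open import Data.Nat using (ℕ; _≤_; _∸_)
open import Data.Nat.Combinatorics using (_C_)
open import Data.Integer using (+_; _-_; _*_)
open import Data.Fin using (Fin)
open import Relation.Binary.PropositionalEquality using (_≡_)

open import Data.Bool using (Bool; true; false; _∧_; if_then_else_; T?)
open import Data.Empty using (⊥-elim)
open import Data.Fin using (zero; suc; _≟_)
open import Data.Fin.Subset using (Subset; _∩_; _∪_; ∣_∣; ⊥; _⊆_)
open import Data.Fin.Subset.Properties using (_⊆?_; drop-∷-⊆; p⊆q⇒∣p∣≤∣q∣; ∣⊥∣≡0; ∩-zeroˡ; ∪-identityˡ; x∈p∩q⁺; x∈p∩q⁻)
open import Data.Integer using (ℤ; -_; _+_)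
import Data.Integer.Properties as ℤₚ
open import Data.Integer.Tactic.RingSolver using (solve-∀)
open import Data.List using (List; []; _∷_; _++_; map; concatMap; foldr; filter; length; upTo; applyUpTo; allFin)
import Data.Fin.Properties as Finₚ
import Data.List.Properties as Listₚ
import Data.Nat as ℕ
import Data.Nat.Properties as ℕₚ
import Data.Nat.Combinatorics as ℕᶜ
import Data.Nat.Tactic.RingSolver as ℕSolver
open import Data.Product using (_,_; proj₁; proj₂)
open import Data.Vec using ([]; _∷_; here; tabulate)
open import Function using (_∘_)
open import Relation.Nullary using (Dec; yes; no; does)
open import Relation.Nullary.Decidable using (⌊_⌋)
open import Relation.Nullary.Reflects using (ofʸ; ofⁿ)
open import Relation.Binary.PropositionalEquality using (refl; sym; trans; cong; cong₂; subst; _≢_; module ≡-Reasoning)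

open ≡-Reasoning

infixr 6.5 [_]·_

[_]·_ : Bool → ℤ → ℤ
[ b ]· x = if b then x else + 0

[]·-zero : ∀ b → [ b ]· + 0 ≡ + 0
[]·-zero true  = refl
[]·-zero false = refl

[]·-∧ : ∀ a b x → [ a ∧ b ]· x ≡ [ a ]· [ b ]· x
[]·-∧ true  b x = refl
[]·-∧ false b x = refl

[]·-comm : ∀ a b x → [ a ]· [ b ]· x ≡ [ b ]· [ a ]· x
[]·-comm true  b x = refl
[]·-comm false b x = sym ([]·-zero b)

[]·-*ˡ : ∀ b x y → x * ([ b ]· y) ≡ [ b ]· (x * y)
[]·-*ˡ true  x y = refl
[]·-*ˡ false x y = ℤₚ.*-zeroʳ x

[]·1-* : ∀ b x → ([ b ]· + 1) * x ≡ [ b ]· x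
[]·1-* true  x = ℤₚ.*-identityˡ x
[]·1-* false x = refl

module _ {A : Set} where

  ∑ : List A → (A → ℤ) → ℤ
  ∑ xs f = sumℤ (map f xs)

  ∑-cong : ∀ (xs : List A) {f g : A → ℤ} → (∀ x → f x ≡ g x) → ∑ xs f ≡ ∑ xs g
  ∑-cong []       e = refl
  ∑-cong (x ∷ xs) e = cong₂ _+_ (e x) (∑-cong xs e)

  ∑-++ : ∀ (xs ys : List A) f → ∑ (xs ++ ys) f ≡ ∑ xs f + ∑ ys f
  ∑-++ []       ys f = sym (ℤₚ.+-identityˡ _)
  ∑-++ (x ∷ xs) ys f = trans (cong (_+_ (f x)) (∑-++ xs ys f)) (sym (ℤₚ.+-assoc (f x) _ _))

  ∑-zero : ∀ (xs : List A) → ∑ xs (λ _ → + 0) ≡ + 0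
  ∑-zero []       = refl
  ∑-zero (x ∷ xs) = trans (ℤₚ.+-identityˡ _) (∑-zero xs)

  ∑-+ : ∀ (xs : List A) f g → ∑ xs (λ x → f x + g x) ≡ ∑ xs f + ∑ xs g
  ∑-+ []       f g = refl
  ∑-+ (x ∷ xs) f g = trans (cong (_+_ (f x + g x)) (∑-+ xs f g)) (interchange (f x) (g x) _ _)
    where
    interchange : ∀ a b c d → a + b + (c + d) ≡ a + c + (b + d)
    interchange = solve-∀

  ∑-neg : ∀ (xs : List A) f → ∑ xs (λ x → - f x) ≡ - ∑ xs f
  ∑-neg []       f = refl
  ∑-neg (x ∷ xs) f = trans (cong (_+_ (- f x)) (∑-neg xs f)) (sym (ℤₚ.neg-distrib-+ (f x) _))

  ∑-- : ∀ (xs : List A) f g → ∑ xs (λ x → f x - g x) ≡ ∑ xs f - ∑ xs g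
  ∑-- xs f g = trans (∑-+ xs f (λ x → - g x)) (cong (_+_ (∑ xs f)) (∑-neg xs g))

  ∑-*ˡ : ∀ (xs : List A) c f → ∑ xs (λ x → c * f x) ≡ c * ∑ xs f
  ∑-*ˡ []       c f = sym (ℤₚ.*-zeroʳ c)
  ∑-*ˡ (x ∷ xs) c f = trans (cong (_+_ (c * f x)) (∑-*ˡ xs c f)) (sym (ℤₚ.*-distribˡ-+ c (f x) _))

  ∑-*ʳ : ∀ (xs : List A) c f → ∑ xs (λ x → f x * c) ≡ ∑ xs f * c
  ∑-*ʳ xs c f = trans (∑-cong xs (λ x → ℤₚ.*-comm (f x) c)) (trans (∑-*ˡ xs c f) (ℤₚ.*-comm c _))

  ∑-[]· : ∀ (xs : List A) b f → ∑ xs (λ x → [ b ]· f x) ≡ [ b ]· ∑ xs f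
  ∑-[]· xs true  f = refl
  ∑-[]· xs false f = ∑-zero xs

module _ {A B : Set} where

  ∑-map : ∀ (g : A → B) (xs : List A) f → ∑ (map g xs) f ≡ ∑ xs (f ∘ g)
  ∑-map g xs f = cong sumℤ (sym (Listₚ.map-∘ xs))

  ∑-concatMap : ∀ (g : A → List B) (xs : List A) f → ∑ (concatMap g xs) f ≡ ∑ xs (λ x → ∑ (g x) f)
  ∑-concatMap g []       f = refl
  ∑-concatMap g (x ∷ xs) f = trans (∑-++ (g x) (concatMap g xs) f) (cong (_+_ (∑ (g x) f)) (∑-concatMap g xs f))

  ∑-comm : ∀ (xs : List A) (ys : List B) (f : A → B → ℤ) →
    ∑ xs (λ x → ∑ ys (f x)) ≡ ∑ ys (λ y → ∑ xs (λ x → f x y))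
  ∑-comm []       ys f = sym (∑-zero ys)
  ∑-comm (x ∷ xs) ys f =
    trans (cong (_+_ (∑ ys (f x))) (∑-comm xs ys f)) (sym (∑-+ ys (f x) (λ y → ∑ xs (λ x′ → f x′ y))))

sign-+ : ∀ m n → sign (m ℕ.+ n) ≡ sign m * sign n
sign-+ ℕ.zero    n = sym (ℤₚ.*-identityˡ _)
sign-+ (ℕ.suc m) n = trans (cong -_ (sign-+ m n)) (ℤₚ.neg-distribˡ-* (sign m) (sign n))

sign*sign≡1 : ∀ k → sign k * sign k ≡ + 1
sign*sign≡1 ℕ.zero    = refl
sign*sign≡1 (ℕ.suc k) = trans (neg*neg (sign k)) (sign*sign≡1 k)
  where
  neg*neg : ∀ x → - x * - x ≡ x * x
  neg*neg = solve-∀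

sign-∸ : ∀ m n → n ≤ m → sign (m ∸ n) ≡ sign m * sign n
sign-∸ m n n≤m = begin
  sign (m ∸ n)                        ≡⟨ sym (ℤₚ.*-identityʳ _) ⟩
  sign (m ∸ n) * + 1                  ≡⟨ cong (sign (m ∸ n) *_) (sym (sign*sign≡1 n)) ⟩
  sign (m ∸ n) * (sign n * sign n)    ≡⟨ sym (ℤₚ.*-assoc (sign (m ∸ n)) _ _) ⟩
  sign (m ∸ n) * sign n * sign n      ≡⟨ cong (_* sign n) (sym (sign-+ (m ∸ n) n)) ⟩
  sign (m ∸ n ℕ.+ n) * sign n         ≡⟨ cong (λ k → sign k * sign n) (ℕₚ.m∸n+n≡m n≤m) ⟩
  sign m * sign n                     ∎

χSphere≡1-sign : ∀ d → χSphere d ≡ + 1 - sign d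
χSphere≡1-sign ℕ.zero    = refl
χSphere≡1-sign (ℕ.suc j) = cong (_+_ (+ 1)) (sym (ℤₚ.neg-involutive (sign j)))

∑ₛ : ∀ n → (Subset n → ℤ) → ℤ
∑ₛ n f = ∑ (subsets n) f

∑ₛ-suc : ∀ n f → ∑ₛ (ℕ.suc n) f ≡ ∑ₛ n (λ s → f (false ∷ s) + f (true ∷ s))
∑ₛ-suc n f = trans (∑-concatMap (λ s → (false ∷ s) ∷ (true ∷ s) ∷ []) (subsets n) f)
  (∑-cong (subsets n) λ s → cong (_+_ (f (false ∷ s))) (ℤₚ.+-identityʳ _))

∑ₛ-at-⊥ : ∀ n (g : Subset n → ℤ) → (∀ ρ → 0 ℕ.< ∣ ρ ∣ → g ρ ≡ + 0) → ∑ₛ n g ≡ g ⊥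
∑ₛ-at-⊥ ℕ.zero    g g₊≡0 = ℤₚ.+-identityʳ _
∑ₛ-at-⊥ (ℕ.suc n) g g₊≡0 = begin
  ∑ₛ (ℕ.suc n) g                                ≡⟨ ∑ₛ-suc n g ⟩
  ∑ₛ n (λ s → g (false ∷ s) + g (true ∷ s))     ≡⟨ ∑-cong (subsets n) drop-inside ⟩
  ∑ₛ n (λ s → g (false ∷ s))                    ≡⟨ ∑ₛ-at-⊥ n (g ∘ (false ∷_)) (g₊≡0 ∘ (false ∷_)) ⟩
  g ⊥                                           ∎
  where
  drop-inside : ∀ s → g (false ∷ s) + g (true ∷ s) ≡ g (false ∷ s)
  drop-inside s = trans (cong (_+_ (g (false ∷ s))) (g₊≡0 (true ∷ s) (ℕ.s≤s ℕ.z≤n))) (ℤₚ.+-identityʳ _)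

≡ᵇ0-pos : ∀ {k} → 0 ℕ.< k → (k ℕ.≡ᵇ 0) ≡ false
≡ᵇ0-pos (ℕ.s≤s _) = refl

_⊆ᵇ_ : ∀ {n} → Subset n → Subset n → Bool
ρ ⊆ᵇ σ = does (ρ ⊆? σ)

⊆ᵇ⇒⊆ : ∀ {n} {ρ σ : Subset n} → ρ ⊆ᵇ σ ≡ true → ρ ⊆ σ
⊆ᵇ⇒⊆ {ρ = ρ} {σ} = witness (ρ ⊆? σ)
  where
  witness : (ρ⊆?σ : Dec (ρ ⊆ σ)) → does ρ⊆?σ ≡ true → ρ ⊆ σ
  witness (yes ρ⊆σ) _ = ρ⊆σ

∑ₛ-sign-⊆ᵇ : ∀ n (σ : Subset n) → ∑ₛ n (λ ρ → [ ρ ⊆ᵇ σ ]· sign ∣ ρ ∣) ≡ [ ∣ σ ∣ ℕ.≡ᵇ 0 ]· + 1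
∑ₛ-sign-⊆ᵇ ℕ.zero    []          = refl
∑ₛ-sign-⊆ᵇ (ℕ.suc n) (false ∷ σ) = begin
  _                                                   ≡⟨ ∑ₛ-suc n _ ⟩
  ∑ₛ n (λ ρ → [ ρ ⊆ᵇ σ ]· sign ∣ ρ ∣ + + 0)           ≡⟨ ∑-cong (subsets n) (λ ρ → ℤₚ.+-identityʳ _) ⟩
  ∑ₛ n (λ ρ → [ ρ ⊆ᵇ σ ]· sign ∣ ρ ∣)                 ≡⟨ ∑ₛ-sign-⊆ᵇ n σ ⟩
  _                                                   ∎
∑ₛ-sign-⊆ᵇ (ℕ.suc n) (true ∷ σ)  = trans (∑ₛ-suc n _) (trans (∑-cong (subsets n) cancel) (∑-zero (subsets n)))
  where
  cancel : ∀ ρ → [ ρ ⊆ᵇ σ ]· sign ∣ ρ ∣ + [ ρ ⊆ᵇ σ ]· - sign ∣ ρ ∣ ≡ + 0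
  cancel ρ with ρ ⊆ᵇ σ
  ... | true  = ℤₚ.+-inverseʳ (sign ∣ ρ ∣)
  ... | false = refl

-- Reindexing by τ ↦ τ ∪ ρ: the sets disjoint from ρ correspond to the supersets of ρ.
∑ₛ-disjoint-∪ : ∀ {n} (ρ : Subset n) (H : Subset n → ℕ → ℤ) →
  ∑ₛ n (λ τ → [ ∣ τ ∩ ρ ∣ ℕ.≡ᵇ 0 ]· H (τ ∪ ρ) (∣ τ ∣ ℕ.+ ∣ ρ ∣)) ≡ ∑ₛ n (λ σ → [ ρ ⊆ᵇ σ ]· H σ ∣ σ ∣)
∑ₛ-disjoint-∪ []                      H = refl
∑ₛ-disjoint-∪ {ℕ.suc n} (false ∷ ρ) H = begin
  _ ≡⟨ ∑ₛ-suc n _ ⟩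
  _ ≡⟨ ∑-+ (subsets n) _ _ ⟩
  _ ≡⟨ cong₂ _+_ (∑ₛ-disjoint-∪ ρ (λ s k → H (false ∷ s) k)) (∑ₛ-disjoint-∪ ρ (λ s k → H (true ∷ s) (ℕ.suc k))) ⟩
  _ ≡⟨ sym (∑-+ (subsets n) _ _) ⟩
  _ ≡⟨ sym (∑ₛ-suc n _) ⟩
  _ ∎
∑ₛ-disjoint-∪ {ℕ.suc n} (true ∷ ρ)  H = begin
  _ ≡⟨ ∑ₛ-suc n _ ⟩
  ∑ₛ n (λ τ → [ ∣ τ ∩ ρ ∣ ℕ.≡ᵇ 0 ]· H (true ∷ τ ∪ ρ) (∣ τ ∣ ℕ.+ ℕ.suc ∣ ρ ∣) + + 0)
    ≡⟨ ∑-cong (subsets n) (λ τ → trans (ℤₚ.+-identityʳ _)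
         (cong (λ k → [ ∣ τ ∩ ρ ∣ ℕ.≡ᵇ 0 ]· H (true ∷ τ ∪ ρ) k) (ℕₚ.+-suc ∣ τ ∣ ∣ ρ ∣))) ⟩
  _ ≡⟨ ∑ₛ-disjoint-∪ ρ (λ s k → H (true ∷ s) (ℕ.suc k)) ⟩
  _ ≡⟨ ∑-cong (subsets n) (λ σ → sym (ℤₚ.+-identityˡ _)) ⟩
  _ ≡⟨ sym (∑ₛ-suc n _) ⟩
  _ ∎

⊆∧∣∣≤⇒≡ : ∀ {n} (p q : Subset n) → p ⊆ q → ∣ q ∣ ≤ ∣ p ∣ → p ≡ q
⊆∧∣∣≤⇒≡ []          []          p⊆q q≤p = refl
⊆∧∣∣≤⇒≡ (false ∷ p) (false ∷ q) p⊆q q≤p = cong (false ∷_) (⊆∧∣∣≤⇒≡ p q (drop-∷-⊆ p⊆q) q≤p)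
⊆∧∣∣≤⇒≡ (true ∷ p)  (true ∷ q)  p⊆q (ℕ.s≤s q≤p) = cong (true ∷_) (⊆∧∣∣≤⇒≡ p q (drop-∷-⊆ p⊆q) q≤p)
⊆∧∣∣≤⇒≡ (false ∷ p) (true ∷ q)  p⊆q q≤p =
  ⊥-elim (ℕₚ.<-irrefl refl (ℕₚ.≤-trans q≤p (p⊆q⇒∣p∣≤∣q∣ (drop-∷-⊆ p⊆q))))
⊆∧∣∣≤⇒≡ (true ∷ p)  (false ∷ q) p⊆q q≤p with p⊆q here
... | ()

private
  reducedSign : ℕ → ℤ
  reducedSign ℕ.zero    = + 0
  reducedSign (ℕ.suc k) = sign k

-- `eulerChar` weighs faces by a function local to its definition; this names it.
eulerChar≡∑ₛ : ∀ n (Q : Subset n → Bool) → eulerChar Q ≡ ∑ₛ n (λ s → [ Q s ]· reducedSign ∣ s ∣)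
eulerChar≡∑ₛ ℕ.zero    Q = refl
eulerChar≡∑ₛ (ℕ.suc n) Q = begin
  eulerChar Q ≡⟨ ∑ₛ-suc n _ ⟩
  _           ≡⟨ ∑-+ (subsets n) _ _ ⟩
  _           ≡⟨ cong (_+ ∑ₛ n (λ s → [ Q (true ∷ s) ]· sign ∣ s ∣)) (eulerChar≡∑ₛ n (Q ∘ (false ∷_))) ⟩
  _           ≡⟨ sym (∑-+ (subsets n) _ _) ⟩
  _           ≡⟨ sym (∑ₛ-suc n _) ⟩
  _           ∎

∑ₛ-sign≡1-eulerChar : ∀ {n} (Q : Subset n → Bool) → Q ⊥ ≡ true →
  ∑ₛ n (λ s → [ Q s ]· sign ∣ s ∣) ≡ + 1 - eulerChar Q
∑ₛ-sign≡1-eulerChar {n} Q Q⊥ = begin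
  ∑ₛ n (λ s → [ Q s ]· sign ∣ s ∣)
    ≡⟨ ∑-cong (subsets n) (λ s → split (Q s) ∣ s ∣) ⟩
  ∑ₛ n (λ s → [ Q s ]· [ ∣ s ∣ ℕ.≡ᵇ 0 ]· + 1 - [ Q s ]· reducedSign ∣ s ∣)
    ≡⟨ ∑-- (subsets n) _ _ ⟩
  _ ≡⟨ cong₂ _-_ (∑ₛ-at-⊥ n _ (λ ρ pos → trans (cong (λ b → [ Q ρ ]· [ b ]· + 1) (≡ᵇ0-pos pos)) ([]·-zero (Q ρ))))
                 (sym (eulerChar≡∑ₛ n Q)) ⟩
  [ Q ⊥ ]· [ ∣ ⊥ {n} ∣ ℕ.≡ᵇ 0 ]· + 1 - eulerChar Q
    ≡⟨ cong₂ (λ b k → [ b ]· [ k ℕ.≡ᵇ 0 ]· + 1 - eulerChar Q) Q⊥ (∣⊥∣≡0 n) ⟩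
  + 1 - eulerChar Q ∎
  where
  split : ∀ b k → [ b ]· sign k ≡ [ b ]· [ k ℕ.≡ᵇ 0 ]· + 1 - [ b ]· reducedSign k
  split false k         = refl
  split true  ℕ.zero    = refl
  split true  (ℕ.suc k) = sym (ℤₚ.+-identityˡ _)

map-allFin-suc : ∀ {A : Set} m (g : Fin (ℕ.suc m) → A) → map g (allFin (ℕ.suc m)) ≡ g zero ∷ map (g ∘ suc) (allFin m)
map-allFin-suc m g = cong (g zero ∷_) (trans (Listₚ.map-tabulate suc g) (sym (Listₚ.map-tabulate (λ i → i) (g ∘ suc))))

prodℤ-suc : ∀ m (g : Fin (ℕ.suc m) → ℤ) → prodℤ (ℕ.suc m) g ≡ g zero * prodℤ m (g ∘ suc)
prodℤ-suc m g = cong (foldr _*_ (+ 1)) (map-allFin-suc m g)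

prodℤ-cong : ∀ m {f g : Fin m → ℤ} → (∀ i → f i ≡ g i) → prodℤ m f ≡ prodℤ m g
prodℤ-cong m e = cong (foldr _*_ (+ 1)) (Listₚ.map-cong e (allFin m))

prodℤ-* : ∀ m (f g : Fin m → ℤ) → prodℤ m (λ j → f j * g j) ≡ prodℤ m f * prodℤ m g
prodℤ-* ℕ.zero    f g = refl
prodℤ-* (ℕ.suc m) f g = begin
  _ ≡⟨ prodℤ-suc m (λ j → f j * g j) ⟩
  f zero * g zero * prodℤ m (λ j → f (suc j) * g (suc j))    ≡⟨ cong (f zero * g zero *_) (prodℤ-* m (f ∘ suc) (g ∘ suc)) ⟩
  f zero * g zero * (prodℤ m (f ∘ suc) * prodℤ m (g ∘ suc))  ≡⟨ interchange (f zero) (g zero) _ _ ⟩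
  f zero * prodℤ m (f ∘ suc) * (g zero * prodℤ m (g ∘ suc))  ≡⟨ sym (cong₂ _*_ (prodℤ-suc m f) (prodℤ-suc m g)) ⟩
  _ ∎
  where
  interchange : ∀ a b c d → a * b * (c * d) ≡ a * c * (b * d)
  interchange = solve-∀

prodℤ-+-at : ∀ m (j₀ : Fin m) (f g h : Fin m → ℤ) → f j₀ + g j₀ ≡ h j₀ →
  (∀ i → i ≢ j₀ → f i ≡ h i) → (∀ i → i ≢ j₀ → g i ≡ h i) → prodℤ m f + prodℤ m g ≡ prodℤ m h
prodℤ-+-at (ℕ.suc m) zero f g h at-j₀ f≡h g≡h = begin
  prodℤ (ℕ.suc m) f + prodℤ (ℕ.suc m) g
    ≡⟨ cong₂ _+_ (prodℤ-suc m f) (prodℤ-suc m g) ⟩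
  f zero * prodℤ m (f ∘ suc) + g zero * prodℤ m (g ∘ suc)
    ≡⟨ cong₂ (λ x y → f zero * x + g zero * y) (prodℤ-cong m (λ i → f≡h (suc i) (λ ()))) (prodℤ-cong m (λ i → g≡h (suc i) (λ ()))) ⟩
  f zero * prodℤ m (h ∘ suc) + g zero * prodℤ m (h ∘ suc)
    ≡⟨ sym (ℤₚ.*-distribʳ-+ _ (f zero) (g zero)) ⟩
  (f zero + g zero) * prodℤ m (h ∘ suc)
    ≡⟨ cong (_* prodℤ m (h ∘ suc)) at-j₀ ⟩
  h zero * prodℤ m (h ∘ suc)
    ≡⟨ sym (prodℤ-suc m h) ⟩
  prodℤ (ℕ.suc m) h ∎
prodℤ-+-at (ℕ.suc m) (suc j₀) f g h at-j₀ f≡h g≡h = begin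
  prodℤ (ℕ.suc m) f + prodℤ (ℕ.suc m) g
    ≡⟨ cong₂ _+_ (prodℤ-suc m f) (prodℤ-suc m g) ⟩
  f zero * prodℤ m (f ∘ suc) + g zero * prodℤ m (g ∘ suc)
    ≡⟨ cong₂ (λ x y → x * prodℤ m (f ∘ suc) + y * prodℤ m (g ∘ suc)) (f≡h zero (λ ())) (g≡h zero (λ ())) ⟩
  h zero * prodℤ m (f ∘ suc) + h zero * prodℤ m (g ∘ suc)
    ≡⟨ sym (ℤₚ.*-distribˡ-+ (h zero) _ _) ⟩
  h zero * (prodℤ m (f ∘ suc) + prodℤ m (g ∘ suc))
    ≡⟨ cong (h zero *_) (prodℤ-+-at m j₀ (f ∘ suc) (g ∘ suc) (h ∘ suc) at-j₀
         (λ i i≢j₀ → f≡h (suc i) (i≢j₀ ∘ Finₚ.suc-injective)) (λ i i≢j₀ → g≡h (suc i) (i≢j₀ ∘ Finₚ.suc-injective))) ⟩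
  h zero * prodℤ m (h ∘ suc)
    ≡⟨ sym (prodℤ-suc m h) ⟩
  prodℤ (ℕ.suc m) h ∎

∣∣v-suc : ∀ {m} (f : Fin (ℕ.suc m) → ℕ) → ∣ f ∣v ≡ f zero ℕ.+ ∣ f ∘ suc ∣v
∣∣v-suc {m} f = cong (foldr ℕ._+_ 0) (map-allFin-suc m f)

∣∣v-cong : ∀ {m} {f g : Fin m → ℕ} → (∀ i → f i ≡ g i) → ∣ f ∣v ≡ ∣ g ∣v
∣∣v-cong {m} e = cong (foldr ℕ._+_ 0) (Listₚ.map-cong e (allFin m))

∣∣v-zero : ∀ m → ∣ (λ (_ : Fin m) → 0) ∣v ≡ 0
∣∣v-zero ℕ.zero    = refl
∣∣v-zero (ℕ.suc m) = trans (∣∣v-suc {m} (λ _ → 0)) (∣∣v-zero m)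

∣∣v-+ : ∀ {m} (f g : Fin m → ℕ) → ∣ (λ j → f j ℕ.+ g j) ∣v ≡ ∣ f ∣v ℕ.+ ∣ g ∣v
∣∣v-+ {ℕ.zero}  f g = refl
∣∣v-+ {ℕ.suc m} f g = begin
  ∣ (λ j → f j ℕ.+ g j) ∣v                          ≡⟨ ∣∣v-suc (λ j → f j ℕ.+ g j) ⟩
  f zero ℕ.+ g zero ℕ.+ ∣ (λ j → f (suc j) ℕ.+ g (suc j)) ∣v
                                                    ≡⟨ cong (f zero ℕ.+ g zero ℕ.+_) (∣∣v-+ (f ∘ suc) (g ∘ suc)) ⟩
  f zero ℕ.+ g zero ℕ.+ (∣ f ∘ suc ∣v ℕ.+ ∣ g ∘ suc ∣v)
                                                    ≡⟨ interchange (f zero) (g zero) _ _ ⟩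
  (f zero ℕ.+ ∣ f ∘ suc ∣v) ℕ.+ (g zero ℕ.+ ∣ g ∘ suc ∣v)
                                                    ≡⟨ sym (cong₂ ℕ._+_ (∣∣v-suc f) (∣∣v-suc g)) ⟩
  ∣ f ∣v ℕ.+ ∣ g ∣v                                 ∎
  where
  interchange : ∀ a b c d → a ℕ.+ b ℕ.+ (c ℕ.+ d) ≡ (a ℕ.+ c) ℕ.+ (b ℕ.+ d)
  interchange = ℕSolver.solve-∀

prodℤ-sign : ∀ m (f : Fin m → ℕ) → prodℤ m (λ j → sign (f j)) ≡ sign ∣ f ∣v
prodℤ-sign ℕ.zero    f = refl
prodℤ-sign (ℕ.suc m) f = begin
  _                                  ≡⟨ prodℤ-suc m (λ j → sign (f j)) ⟩
  sign (f zero) * prodℤ m (λ j → sign (f (suc j)))   ≡⟨ cong (sign (f zero) *_) (prodℤ-sign m (f ∘ suc)) ⟩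
  sign (f zero) * sign ∣ f ∘ suc ∣v  ≡⟨ sym (sign-+ (f zero) _) ⟩
  sign (f zero ℕ.+ ∣ f ∘ suc ∣v)     ≡⟨ cong sign (sym (∣∣v-suc f)) ⟩
  sign ∣ f ∣v                        ∎

δᶠ : ∀ {m} → Fin m → Fin m → ℕ
δᶠ i j = if ⌊ i ≟ j ⌋ then 1 else 0

δᶠ-diag : ∀ {m} (i : Fin m) → δᶠ i i ≡ 1
δᶠ-diag i with i ≟ i
... | yes _  = refl
... | no i≢i = ⊥-elim (i≢i refl)

δᶠ-off : ∀ {m} (i j : Fin m) → j ≢ i → δᶠ i j ≡ 0
δᶠ-off i j j≢i with i ≟ j
... | yes i≡j = ⊥-elim (j≢i (sym i≡j))
... | no _    = refl

∣δᶠ∣v : ∀ {m} (i : Fin m) → ∣ δᶠ i ∣v ≡ 1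
∣δᶠ∣v {ℕ.suc m} zero    = trans (∣∣v-suc {m} (δᶠ zero)) (cong ℕ.suc (∣∣v-zero m))
∣δᶠ∣v {ℕ.suc m} (suc i) = trans (∣∣v-suc (δᶠ (suc i))) (trans (∣∣v-cong shift) (∣δᶠ∣v i))
  where
  shift : ∀ j → δᶠ (suc i) (suc j) ≡ δᶠ i j
  shift j with i ≟ j
  ... | yes _ = refl
  ... | no _  = refl

colorCount-inside : ∀ {n m} (φ : Fin (ℕ.suc n) → Fin m) (ρ : Subset n) j →
  colorCount φ (true ∷ ρ) j ≡ δᶠ (φ zero) j ℕ.+ colorCount (φ ∘ suc) ρ j
colorCount-inside φ ρ j with ⌊ φ zero ≟ j ⌋
... | true  = refl
... | false = refl

∣colorCount∣v : ∀ {m} n (φ : Fin n → Fin m) (σ : Subset n) → ∣ colorCount φ σ ∣v ≡ ∣ σ ∣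
∣colorCount∣v {m} ℕ.zero    φ []          = ∣∣v-zero m
∣colorCount∣v     (ℕ.suc n) φ (false ∷ σ) = ∣colorCount∣v n (φ ∘ suc) σ
∣colorCount∣v     (ℕ.suc n) φ (true ∷ σ)  = begin
  ∣ colorCount φ (true ∷ σ) ∣v                         ≡⟨ ∣∣v-cong (colorCount-inside φ σ) ⟩
  ∣ (λ j → δᶠ (φ zero) j ℕ.+ colorCount (φ ∘ suc) σ j) ∣v ≡⟨ ∣∣v-+ (δᶠ (φ zero)) (colorCount (φ ∘ suc) σ) ⟩
  ∣ δᶠ (φ zero) ∣v ℕ.+ ∣ colorCount (φ ∘ suc) σ ∣v      ≡⟨ cong₂ ℕ._+_ (∣δᶠ∣v (φ zero)) (∣colorCount∣v n (φ ∘ suc) σ) ⟩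
  ℕ.suc ∣ σ ∣                                          ∎

colorCount-⊥ : ∀ {n m} (φ : Fin n → Fin m) j → colorCount φ ⊥ j ≡ 0
colorCount-⊥ {n} φ j = trans (cong ∣_∣ (∩-zeroˡ (tabulate (λ v → ⌊ φ v ≟ j ⌋)))) (∣⊥∣≡0 n)

colorCount-mono : ∀ {n m} (φ : Fin n → Fin m) {σ τ : Subset n} → σ ⊆ τ → ∀ j → colorCount φ σ j ≤ colorCount φ τ j
colorCount-mono φ {σ} σ⊆τ j = p⊆q⇒∣p∣≤∣q∣ λ x∈ → let (x∈σ , x∈C) = x∈p∩q⁻ σ _ x∈ in x∈p∩q⁺ (σ⊆τ x∈σ , x∈C)

-- The coefficients of the fine h-vector

-- hTerm c (a ∸ c) b is the factor (-1)^(b - c) C(a - c, b - c) of h_b; the guard c ≤ b discards the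
-- junk term that the truncated b ∸ c would produce for c > b.
hTerm : ℕ → ℕ → ℕ → ℤ
hTerm p q b = [ p ℕ.<ᵇ ℕ.suc b ]· sign (b ∸ p) * + (q C (b ∸ p))

hTerm-pascal : ∀ p q b → hTerm p (ℕ.suc q) b + hTerm (ℕ.suc p) q b ≡ hTerm p q b
hTerm-pascal ℕ.zero    q ℕ.zero    = refl
hTerm-pascal ℕ.zero    q (ℕ.suc b) = begin
  - sign b * + (ℕ.suc q C ℕ.suc b) + sign b * + (q C b)
    ≡⟨ cong (λ z → - sign b * + z + sign b * + (q C b)) (sym (ℕᶜ.nCk+nC[k+1]≡[n+1]C[k+1] q b)) ⟩
  - sign b * + (q C b ℕ.+ q C ℕ.suc b) + sign b * + (q C b)
    ≡⟨ cong (λ z → - sign b * z + sign b * + (q C b)) (ℤₚ.pos-+ (q C b) _) ⟩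
  - sign b * (+ (q C b) + + (q C ℕ.suc b)) + sign b * + (q C b)
    ≡⟨ cancel (sign b) (+ (q C b)) (+ (q C ℕ.suc b)) ⟩
  - sign b * + (q C ℕ.suc b) ∎
  where
  cancel : ∀ s x y → - s * (x + y) + s * x ≡ - s * y
  cancel = solve-∀
hTerm-pascal (ℕ.suc p) q ℕ.zero    = refl
hTerm-pascal (ℕ.suc p) q (ℕ.suc b) = hTerm-pascal p q b

hTerm-reverse : ∀ k A B → k ≤ A → B ≤ A → hTerm k (A ∸ k) (A ∸ B) ≡ sign A * sign k * hTerm 0 (A ∸ k) B
hTerm-reverse k A B k≤A B≤A with k ℕ.<ᵇ ℕ.suc (A ∸ B) | ℕₚ.<ᵇ-reflects-< k (ℕ.suc (A ∸ B))
... | true  | ofʸ (ℕ.s≤s k≤A∸B) = begin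
  sign (A ∸ B ∸ k) * + ((A ∸ k) C (A ∸ B ∸ k))   ≡⟨ cong (λ z → sign z * + ((A ∸ k) C z)) ∸-swap ⟩
  sign (A ∸ k ∸ B) * + ((A ∸ k) C (A ∸ k ∸ B))   ≡⟨ cong (λ z → sign (A ∸ k ∸ B) * + z) (sym (ℕᶜ.nCk≡nC[n∸k] B≤A∸k)) ⟩
  sign (A ∸ k ∸ B) * + ((A ∸ k) C B)             ≡⟨ cong (_* + ((A ∸ k) C B)) (trans (sign-∸ (A ∸ k) B B≤A∸k) (cong (_* sign B) (sign-∸ A k k≤A))) ⟩
  sign A * sign k * sign B * + ((A ∸ k) C B)     ≡⟨ ℤₚ.*-assoc (sign A * sign k) (sign B) _ ⟩
  sign A * sign k * (sign B * + ((A ∸ k) C B))   ∎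
  where
  ∸-swap : A ∸ B ∸ k ≡ A ∸ k ∸ B
  ∸-swap = trans (ℕₚ.∸-+-assoc A B k) (trans (cong (A ∸_) (ℕₚ.+-comm B k)) (sym (ℕₚ.∸-+-assoc A k B)))
  B≤A∸k : B ≤ A ∸ k
  B≤A∸k = ℕₚ.m+n≤o⇒m≤o∸n B (subst (_≤ A) (ℕₚ.+-comm k B) (ℕₚ.m≤o∸n⇒m+n≤o k B≤A k≤A∸B))
... | false | ofⁿ k≰A∸B = sym (begin
  sign A * sign k * (sign B * + ((A ∸ k) C B))   ≡⟨ cong (λ z → sign A * sign k * (sign B * + z)) (ℕᶜ.k>n⇒nCk≡0 A∸k<B) ⟩
  sign A * sign k * (sign B * + 0)               ≡⟨ cong (sign A * sign k *_) (ℤₚ.*-zeroʳ (sign B)) ⟩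
  sign A * sign k * + 0                          ≡⟨ ℤₚ.*-zeroʳ (sign A * sign k) ⟩
  + 0                                            ∎)
  where
  A∸k<B : A ∸ k ℕ.< B
  A∸k<B = ℕₚ.≰⇒> λ B≤A∸k →
    k≰A∸B (ℕ.s≤s (ℕₚ.m+n≤o⇒m≤o∸n k (subst (_≤ A) (ℕₚ.+-comm B k) (ℕₚ.m≤o∸n⇒m+n≤o B k≤A B≤A∸k))))

hProd : ∀ {m} → (p q b : Fin m → ℕ) → ℤ
hProd {m} p q b = prodℤ m (λ j → hTerm (p j) (q j) (b j))

hProd-zero : ∀ {m} (q b : Fin m → ℕ) → hProd (λ _ → 0) q b ≡ sign ∣ b ∣v * prodℤ m (λ j → + (q j C b j))
hProd-zero {m} q b = trans (prodℤ-* m (λ j → sign (b j)) (λ j → + (q j C b j))) (cong (_* prodℤ m (λ j → + (q j C b j))) (prodℤ-sign m b))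

hProd-reverse : ∀ {m} (a t b : Fin m → ℕ) → (∀ j → t j ≤ a j) → b ≤v a →
  hProd t (λ j → a j ∸ t j) (λ j → a j ∸ b j) ≡ sign ∣ a ∣v * sign ∣ t ∣v * hProd (λ _ → 0) (λ j → a j ∸ t j) b
hProd-reverse {m} a t b t≤a b≤a = begin
  hProd t (λ j → a j ∸ t j) (λ j → a j ∸ b j)
    ≡⟨ prodℤ-cong m (λ j → hTerm-reverse (t j) (a j) (b j) (t≤a j) (b≤a j)) ⟩
  prodℤ m (λ j → sign (a j) * sign (t j) * hTerm 0 (a j ∸ t j) (b j))
    ≡⟨ prodℤ-* m _ _ ⟩
  prodℤ m (λ j → sign (a j) * sign (t j)) * hProd (λ _ → 0) (λ j → a j ∸ t j) b
    ≡⟨ cong (_* hProd (λ _ → 0) (λ j → a j ∸ t j) b)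
         (trans (prodℤ-* m _ _) (cong₂ _*_ (prodℤ-sign m a) (prodℤ-sign m t))) ⟩
  sign ∣ a ∣v * sign ∣ t ∣v * hProd (λ _ → 0) (λ j → a j ∸ t j) b ∎

hProd-pascal : ∀ {m} (i : Fin m) (p r b : Fin m → ℕ) →
  hProd p (λ j → δᶠ i j ℕ.+ r j) b + hProd (λ j → p j ℕ.+ δᶠ i j) r b ≡ hProd p r b
hProd-pascal {m} i p r b = prodℤ-+-at m i _ _ _ at-i off-i off-i′
  where
  at-i : hTerm (p i) (δᶠ i i ℕ.+ r i) (b i) + hTerm (p i ℕ.+ δᶠ i i) (r i) (b i) ≡ hTerm (p i) (r i) (b i)
  at-i rewrite δᶠ-diag i | ℕₚ.+-comm (p i) 1 = hTerm-pascal (p i) (r i) (b i)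
  off-i : ∀ j → j ≢ i → hTerm (p j) (δᶠ i j ℕ.+ r j) (b j) ≡ hTerm (p j) (r j) (b j)
  off-i j j≢i rewrite δᶠ-off i j j≢i = refl
  off-i′ : ∀ j → j ≢ i → hTerm (p j ℕ.+ δᶠ i j) (r j) (b j) ≡ hTerm (p j) (r j) (b j)
  off-i′ j j≢i rewrite δᶠ-off i j j≢i | ℕₚ.+-identityʳ (p j) = refl

-- Summing over the subsets of σ peels the vertices of σ off one at a time, each step being
-- Pascal's rule in the colour of the removed vertex.
∑ₛ-⊆ᵇ-hProd : ∀ {m} n (φ : Fin n → Fin m) (σ : Subset n) (p q b : Fin m → ℕ) → (∀ j → colorCount φ σ j ≤ q j) →
  ∑ₛ n (λ ρ → [ ρ ⊆ᵇ σ ]· hProd (λ j → p j ℕ.+ colorCount φ ρ j) (λ j → q j ∸ colorCount φ ρ j) b)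
    ≡ hProd p (λ j → q j ∸ colorCount φ σ j) b
∑ₛ-⊆ᵇ-hProd {m} ℕ.zero φ [] p q b _ =
  trans (ℤₚ.+-identityʳ _) (prodℤ-cong m (λ j → cong (λ z → hTerm z (q j) (b j)) (ℕₚ.+-identityʳ (p j))))
∑ₛ-⊆ᵇ-hProd (ℕ.suc n) φ (false ∷ σ) p q b σ≤q =
  trans (∑ₛ-suc n _) (trans (∑-cong (subsets n) (λ _ → ℤₚ.+-identityʳ _)) (∑ₛ-⊆ᵇ-hProd n (φ ∘ suc) σ p q b σ≤q))
∑ₛ-⊆ᵇ-hProd {m} (ℕ.suc n) φ (true ∷ σ) p q b σ≤q = begin
  _ ≡⟨ ∑ₛ-suc n _ ⟩
  ∑ₛ n (λ ρ → F p q ρ + [ ρ ⊆ᵇ σ ]· hProd (λ j → p j ℕ.+ colorCount φ (true ∷ ρ) j) (λ j → q j ∸ colorCount φ (true ∷ ρ) j) b)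
    ≡⟨ ∑-cong (subsets n) (λ ρ → cong (λ z → F p q ρ + [ ρ ⊆ᵇ σ ]· z) (prodℤ-cong m (peel ρ))) ⟩
  ∑ₛ n (λ ρ → F p q ρ + F (λ j → p j ℕ.+ e j) (λ j → q j ∸ e j) ρ)
    ≡⟨ ∑-+ (subsets n) _ _ ⟩
  _ ≡⟨ cong₂ _+_ (∑ₛ-⊆ᵇ-hProd n φ′ σ p q b (λ j → ℕₚ.m+n≤o⇒n≤o (e j) (e+c≤q j)))
                 (∑ₛ-⊆ᵇ-hProd n φ′ σ (λ j → p j ℕ.+ e j) (λ j → q j ∸ e j) b
                   (λ j → ℕₚ.m+n≤o⇒m≤o∸n (c j) (subst (_≤ q j) (ℕₚ.+-comm (e j) (c j)) (e+c≤q j)))) ⟩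
  hProd p (λ j → q j ∸ c j) b + hProd (λ j → p j ℕ.+ e j) (λ j → q j ∸ e j ∸ c j) b
    ≡⟨ cong₂ _+_ (prodℤ-cong m (λ j → cong (λ z → hTerm (p j) z (b j)) (remaining j)))
                 (prodℤ-cong m (λ j → cong (λ z → hTerm (p j ℕ.+ e j) z (b j)) (ℕₚ.∸-+-assoc (q j) (e j) (c j)))) ⟩
  hProd p (λ j → e j ℕ.+ (q j ∸ (e j ℕ.+ c j))) b + hProd (λ j → p j ℕ.+ e j) (λ j → q j ∸ (e j ℕ.+ c j)) b
    ≡⟨ hProd-pascal (φ zero) p (λ j → q j ∸ (e j ℕ.+ c j)) b ⟩
  hProd p (λ j → q j ∸ (e j ℕ.+ c j)) b
    ≡⟨ prodℤ-cong m (λ j → cong (λ z → hTerm (p j) (q j ∸ z) (b j)) (sym (colorCount-inside φ σ j))) ⟩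
  _ ∎
  where
  φ′ = φ ∘ suc
  e = δᶠ (φ zero)
  c = colorCount φ′ σ
  F : (p q : Fin m → ℕ) → Subset n → ℤ
  F p q ρ = [ ρ ⊆ᵇ σ ]· hProd (λ j → p j ℕ.+ colorCount φ′ ρ j) (λ j → q j ∸ colorCount φ′ ρ j) b
  e+c≤q : ∀ j → e j ℕ.+ c j ≤ q j
  e+c≤q j = subst (_≤ q j) (colorCount-inside φ σ j) (σ≤q j)
  peel : ∀ ρ j → hTerm (p j ℕ.+ colorCount φ (true ∷ ρ) j) (q j ∸ colorCount φ (true ∷ ρ) j) (b j)
               ≡ hTerm (p j ℕ.+ e j ℕ.+ colorCount φ′ ρ j) (q j ∸ e j ∸ colorCount φ′ ρ j) (b j)
  peel ρ j rewrite colorCount-inside φ ρ j =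
    cong₂ (λ x y → hTerm x y (b j)) (sym (ℕₚ.+-assoc (p j) (e j) _)) (sym (ℕₚ.∸-+-assoc (q j) (e j) _))
  remaining : ∀ j → q j ∸ c j ≡ e j ℕ.+ (q j ∸ (e j ℕ.+ c j))
  remaining j = begin
    q j ∸ c j                       ≡⟨ cong (_∸ c j) (sym (ℕₚ.m+[n∸m]≡n (ℕₚ.m+n≤o⇒m≤o (e j) (e+c≤q j)))) ⟩
    e j ℕ.+ (q j ∸ e j) ∸ c j       ≡⟨ ℕₚ.+-∸-assoc (e j) (ℕₚ.m+n≤o⇒m≤o∸n (c j) (subst (_≤ q j) (ℕₚ.+-comm (e j) (c j)) (e+c≤q j))) ⟩
    e j ℕ.+ (q j ∸ e j ∸ c j)       ≡⟨ cong (e j ℕ.+_) (ℕₚ.∸-+-assoc (q j) (e j) (c j)) ⟩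
    e j ℕ.+ (q j ∸ (e j ℕ.+ c j))   ∎

-- The fine h-vector as a sum over faces

faceSum : ∀ {n} → SimplicialComplex n → (Subset n → ℤ) → ℤ
faceSum {n} Δ f = ∑ₛ n (λ σ → [ face Δ σ ]· f σ)

faceSum-cong : ∀ {n} (Δ : SimplicialComplex n) {f g : Subset n → ℤ} → (∀ σ → IsFace Δ σ → f σ ≡ g σ) →
  faceSum Δ f ≡ faceSum Δ g
faceSum-cong {n} Δ {f} {g} f≡g = ∑-cong (subsets n) on-faces
  where
  on-faces : ∀ σ → [ face Δ σ ]· f σ ≡ [ face Δ σ ]· g σ
  on-faces σ with face Δ σ in σ∈Δ
  ... | true  = f≡g σ σ∈Δ
  ... | false = refl

+length-filter : ∀ {A : Set} (P : A → Bool) (xs : List A) →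
  + length (filter (λ x → T? (P x)) xs) ≡ ∑ xs (λ x → [ P x ]· + 1)
+length-filter P []       = refl
+length-filter P (x ∷ xs) with P x
... | true  = cong (_+_ (+ 1)) (+length-filter P xs)
... | false = trans (+length-filter P xs) (sym (ℤₚ.+-identityˡ _))

allEq-suc : ∀ m (u c : Fin (ℕ.suc m) → ℕ) → allEq u c ≡ ((u zero ℕ.≡ᵇ c zero) ∧ allEq (u ∘ suc) (c ∘ suc))
allEq-suc m u c = cong (foldr _∧_ true) (map-allFin-suc m (λ j → u j ℕ.≡ᵇ c j))

allEq-cong : ∀ m (u : Fin m → ℕ) {c c′ : Fin m → ℕ} → (∀ j → c j ≡ c′ j) → allEq u c ≡ allEq u c′
allEq-cong m u c≡c′ = cong (foldr _∧_ true) (Listₚ.map-cong (λ j → cong (u j ℕ.≡ᵇ_) (c≡c′ j)) (allFin m))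

∑-upTo-≡ᵇ : ∀ N u (h : ℕ → ℤ) → ∑ (upTo N) (λ i → [ u ℕ.≡ᵇ i ]· h i) ≡ [ u ℕ.<ᵇ N ]· h u
∑-upTo-≡ᵇ N u h = trans (cong sumℤ (Listₚ.map-applyUpTo (λ i → i) _ N)) (applyUpTo-≡ᵇ N u h)
  where
  applyUpTo-≡ᵇ : ∀ N u (h : ℕ → ℤ) → sumℤ (applyUpTo (λ i → [ u ℕ.≡ᵇ i ]· h i) N) ≡ [ u ℕ.<ᵇ N ]· h u
  applyUpTo-≡ᵇ ℕ.zero    u         h = refl
  applyUpTo-≡ᵇ (ℕ.suc N) ℕ.zero    h =
    trans (cong (_+_ (h 0)) (trans (cong sumℤ (sym (Listₚ.map-applyUpTo (λ i → i) _ N))) (∑-zero (upTo N)))) (ℤₚ.+-identityʳ _)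
  applyUpTo-≡ᵇ (ℕ.suc N) (ℕ.suc u) h = trans (ℤₚ.+-identityˡ _) (applyUpTo-≡ᵇ N u (h ∘ ℕ.suc))

∑-box : ∀ m (x u : Fin m → ℕ) (g : Fin m → ℕ → ℤ) →
  ∑ (box m x) (λ c → [ allEq u c ]· prodℤ m (λ i → g i (c i))) ≡ prodℤ m (λ i → [ u i ℕ.<ᵇ ℕ.suc (x i) ]· g i (u i))
∑-box ℕ.zero    x u g = refl
∑-box (ℕ.suc m) x u g = box-step _ (λ _ _ → refl) (λ _ _ _ → refl)
  where
  -- `box` prepends coordinates with a function local to its definition; it is abstracted as `k`
  -- together with its two defining equations.
  box-step : (k : ℕ → (Fin m → ℕ) → Fin (ℕ.suc m) → ℕ) → (∀ i c → k i c zero ≡ i) → (∀ i c j → k i c (suc j) ≡ c j) →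
    ∑ (concatMap (λ i → map (k i) (box m (x ∘ suc))) (upTo (ℕ.suc (x zero))))
      (λ c → [ allEq u c ]· prodℤ (ℕ.suc m) (λ i → g i (c i)))
      ≡ prodℤ (ℕ.suc m) (λ i → [ u i ℕ.<ᵇ ℕ.suc (x i) ]· g i (u i))
  box-step k k-zero k-suc = begin
    _ ≡⟨ ∑-concatMap (λ i → map (k i) (box m (x ∘ suc))) (upTo (ℕ.suc (x zero))) _ ⟩
    ∑ (upTo (ℕ.suc (x zero))) (λ i → ∑ (map (k i) (box m (x ∘ suc))) T)
      ≡⟨ ∑-cong (upTo (ℕ.suc (x zero))) (λ i → trans (∑-map (k i) (box m (x ∘ suc)) T) (∑-cong (box m (x ∘ suc)) (split i))) ⟩
    ∑ (upTo (ℕ.suc (x zero))) (λ i → ∑ (box m (x ∘ suc)) (λ c → ([ u zero ℕ.≡ᵇ i ]· g zero i) * R c))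
      ≡⟨ ∑-cong (upTo (ℕ.suc (x zero))) (λ i → ∑-*ˡ (box m (x ∘ suc)) ([ u zero ℕ.≡ᵇ i ]· g zero i) R) ⟩
    ∑ (upTo (ℕ.suc (x zero))) (λ i → ([ u zero ℕ.≡ᵇ i ]· g zero i) * ∑ (box m (x ∘ suc)) R)
      ≡⟨ ∑-*ʳ (upTo (ℕ.suc (x zero))) (∑ (box m (x ∘ suc)) R) (λ i → [ u zero ℕ.≡ᵇ i ]· g zero i) ⟩
    ∑ (upTo (ℕ.suc (x zero))) (λ i → [ u zero ℕ.≡ᵇ i ]· g zero i) * ∑ (box m (x ∘ suc)) R
      ≡⟨ cong₂ _*_ (∑-upTo-≡ᵇ (ℕ.suc (x zero)) (u zero) (g zero)) (∑-box m (x ∘ suc) (u ∘ suc) (g ∘ suc)) ⟩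
    _ ≡⟨ sym (prodℤ-suc m (λ i → [ u i ℕ.<ᵇ ℕ.suc (x i) ]· g i (u i))) ⟩
    _ ∎
    where
    T : (Fin (ℕ.suc m) → ℕ) → ℤ
    T c = [ allEq u c ]· prodℤ (ℕ.suc m) (λ i → g i (c i))
    R : (Fin m → ℕ) → ℤ
    R c = [ allEq (u ∘ suc) c ]· prodℤ m (λ i → g (suc i) (c i))
    split : ∀ i c → T (k i c) ≡ ([ u zero ℕ.≡ᵇ i ]· g zero i) * R c
    split i c = begin
      T (k i c)
        ≡⟨ cong₂ [_]·_ (allEq-suc m u (k i c)) (prodℤ-suc m (λ j → g j (k i c j))) ⟩
      [ (u zero ℕ.≡ᵇ k i c zero) ∧ allEq (u ∘ suc) (k i c ∘ suc) ]· g zero (k i c zero) * prodℤ m (λ j → g (suc j) (k i c (suc j)))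
        ≡⟨ cong₂ (λ z b → [ (u zero ℕ.≡ᵇ z) ∧ b ]· g zero z * prodℤ m (λ j → g (suc j) (k i c (suc j))))
             (k-zero i c) (allEq-cong m (u ∘ suc) (k-suc i c)) ⟩
      [ (u zero ℕ.≡ᵇ i) ∧ allEq (u ∘ suc) c ]· g zero i * prodℤ m (λ j → g (suc j) (k i c (suc j)))
        ≡⟨ cong (λ z → [ (u zero ℕ.≡ᵇ i) ∧ allEq (u ∘ suc) c ]· g zero i * z) (prodℤ-cong m (λ j → cong (g (suc j)) (k-suc i c j))) ⟩
      [ (u zero ℕ.≡ᵇ i) ∧ allEq (u ∘ suc) c ]· g zero i * prodℤ m (λ j → g (suc j) (c j))
        ≡⟨ []·-∧-* (u zero ℕ.≡ᵇ i) (allEq (u ∘ suc) c) (g zero i) _ ⟩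
      ([ u zero ℕ.≡ᵇ i ]· g zero i) * R c ∎
      where
      []·-∧-* : ∀ a b x y → [ a ∧ b ]· x * y ≡ ([ a ]· x) * ([ b ]· y)
      []·-∧-* true  true  x y = refl
      []·-∧-* true  false x y = sym (ℤₚ.*-zeroʳ x)
      []·-∧-* false b     x y = refl

fineH≡faceSum : ∀ {n m} (Δ : SimplicialComplex n) (φ : Fin n → Fin m) (a x : Fin m → ℕ) →
  fineH Δ φ a x ≡ faceSum Δ (λ ρ → hProd (colorCount φ ρ) (λ j → a j ∸ colorCount φ ρ j) x)
fineH≡faceSum {n} {m} Δ φ a x = begin
  fineH Δ φ a x
    ≡⟨ ∑-cong (box m x) (λ c → cong (_* W c) (+length-filter (λ ρ → face Δ ρ ∧ allEq (colorCount φ ρ) c) (subsets n))) ⟩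
  ∑ (box m x) (λ c → ∑ₛ n (λ ρ → [ face Δ ρ ∧ allEq (colorCount φ ρ) c ]· + 1) * W c)
    ≡⟨ ∑-cong (box m x) (λ c → sym (∑-*ʳ (subsets n) (W c) _)) ⟩
  ∑ (box m x) (λ c → ∑ₛ n (λ ρ → ([ face Δ ρ ∧ allEq (colorCount φ ρ) c ]· + 1) * W c))
    ≡⟨ ∑-comm (box m x) (subsets n) _ ⟩
  ∑ₛ n (λ ρ → ∑ (box m x) (λ c → ([ face Δ ρ ∧ allEq (colorCount φ ρ) c ]· + 1) * W c))
    ≡⟨ ∑-cong (subsets n) (λ ρ → ∑-cong (box m x) (λ c →
         trans ([]·1-* (face Δ ρ ∧ allEq (colorCount φ ρ) c) (W c)) ([]·-∧ (face Δ ρ) _ (W c)))) ⟩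
  ∑ₛ n (λ ρ → ∑ (box m x) (λ c → [ face Δ ρ ]· [ allEq (colorCount φ ρ) c ]· W c))
    ≡⟨ ∑-cong (subsets n) (λ ρ → trans (∑-[]· (box m x) (face Δ ρ) _) (cong (λ z → [ face Δ ρ ]· z) (∑-box m x (colorCount φ ρ) g))) ⟩
  faceSum Δ (λ ρ → hProd (colorCount φ ρ) (λ j → a j ∸ colorCount φ ρ j) x) ∎
  where
  g : Fin m → ℕ → ℤ
  g i k = sign (x i ∸ k) * + ((a i ∸ k) C (x i ∸ k))
  W : (Fin m → ℕ) → ℤ
  W c = prodℤ m (λ i → g i (c i))

pure⇒facet : ∀ {n d} {Δ : SimplicialComplex n} → Pure Δ d → ∀ {σ} → IsFace Δ σ → ∣ σ ∣ ≡ d → IsFacet Δ σ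
pure⇒facet pure {σ} σ∈Δ ∣σ∣≡d =
  σ∈Δ , λ τ τ∈Δ σ⊆τ → sym (⊆∧∣∣≤⇒≡ σ τ σ⊆τ (subst (∣ τ ∣ ≤_) (sym ∣σ∣≡d) (proj₁ pure τ τ∈Δ)))

colorCount≤ : ∀ {n m d} {Δ : SimplicialComplex n} {φ : Fin n → Fin m} {a : Fin m → ℕ} →
  Pure Δ d → Balanced Δ φ a → ∀ {σ} → IsFace Δ σ → ∀ j → colorCount φ σ j ≤ a j
colorCount≤ {Δ = Δ} {φ} pure balanced {σ} σ∈Δ j with proj₂ pure σ σ∈Δ
... | τ , τ∈Δ , σ⊆τ , ∣τ∣≡d =
  subst (colorCount φ σ j ≤_) (proj₂ balanced τ (pure⇒facet {Δ = Δ} pure τ∈Δ ∣τ∣≡d) j) (colorCount-mono φ σ⊆τ j)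

-- Stars and semi-Eulerian duality

starSum : ∀ {n} → SimplicialComplex n → (Subset n → ℤ) → Subset n → ℤ
starSum Δ Z ρ = faceSum Δ (λ σ → [ ρ ⊆ᵇ σ ]· Z σ)

faceSum-∑⊆ᵇ-comm : ∀ {n} (Δ : SimplicialComplex n) (X Z : Subset n → ℤ) →
  faceSum Δ (λ σ → Z σ * ∑ₛ n (λ ρ → [ ρ ⊆ᵇ σ ]· X ρ)) ≡ faceSum Δ (λ ρ → X ρ * starSum Δ Z ρ)
faceSum-∑⊆ᵇ-comm {n} Δ X Z = begin
  faceSum Δ (λ σ → Z σ * ∑ₛ n (λ ρ → [ ρ ⊆ᵇ σ ]· X ρ))   ≡⟨ ∑-cong (subsets n) expand ⟩
  ∑ₛ n (λ σ → ∑ₛ n (λ ρ → T σ ρ))                         ≡⟨ ∑-comm (subsets n) (subsets n) T ⟩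
  ∑ₛ n (λ ρ → ∑ₛ n (λ σ → T σ ρ))                         ≡⟨ ∑-cong (subsets n) collect ⟩
  faceSum Δ (λ ρ → X ρ * starSum Δ Z ρ)                   ∎
  where
  T : Subset n → Subset n → ℤ
  T σ ρ = [ face Δ σ ]· [ ρ ⊆ᵇ σ ]· Z σ * X ρ
  expand : ∀ σ → [ face Δ σ ]· Z σ * ∑ₛ n (λ ρ → [ ρ ⊆ᵇ σ ]· X ρ) ≡ ∑ₛ n (T σ)
  expand σ = begin
    [ face Δ σ ]· Z σ * ∑ₛ n (λ ρ → [ ρ ⊆ᵇ σ ]· X ρ)      ≡⟨ cong (λ z → [ face Δ σ ]· z) (sym (∑-*ˡ (subsets n) (Z σ) _)) ⟩
    [ face Δ σ ]· ∑ₛ n (λ ρ → Z σ * ([ ρ ⊆ᵇ σ ]· X ρ))    ≡⟨ sym (∑-[]· (subsets n) (face Δ σ) _) ⟩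
    ∑ₛ n (λ ρ → [ face Δ σ ]· Z σ * ([ ρ ⊆ᵇ σ ]· X ρ))    ≡⟨ ∑-cong (subsets n) (λ ρ → cong (λ z → [ face Δ σ ]· z) ([]·-*ˡ (ρ ⊆ᵇ σ) (Z σ) (X ρ))) ⟩
    ∑ₛ n (T σ)                                             ∎
  -- A face σ ⊇ ρ forces ρ to be a face.
  absorb : ∀ ρ σ x → [ face Δ σ ]· [ ρ ⊆ᵇ σ ]· x ≡ [ face Δ ρ ]· [ face Δ σ ]· [ ρ ⊆ᵇ σ ]· x
  absorb ρ σ x with face Δ ρ in ρ∈Δ
  ... | true  = refl
  ... | false with face Δ σ in σ∈Δ | ρ ⊆ᵇ σ in ρ⊆σ
  ...   | true  | true  with () ← trans (sym ρ∈Δ) (downClosed Δ σ∈Δ (⊆ᵇ⇒⊆ ρ⊆σ))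
  ...   | true  | false = refl
  ...   | false | _     = refl
  pull : ∀ a b z x → [ a ]· [ b ]· z * x ≡ x * ([ a ]· [ b ]· z)
  pull true  true  z x = ℤₚ.*-comm z x
  pull true  false z x = sym (ℤₚ.*-zeroʳ x)
  pull false b     z x = sym (ℤₚ.*-zeroʳ x)
  collect : ∀ ρ → ∑ₛ n (λ σ → T σ ρ) ≡ [ face Δ ρ ]· X ρ * starSum Δ Z ρ
  collect ρ = begin
    ∑ₛ n (λ σ → T σ ρ)                                      ≡⟨ ∑-cong (subsets n) (λ σ → absorb ρ σ _) ⟩
    ∑ₛ n (λ σ → [ face Δ ρ ]· T σ ρ)                        ≡⟨ ∑-[]· (subsets n) (face Δ ρ) _ ⟩
    [ face Δ ρ ]· ∑ₛ n (λ σ → T σ ρ)                        ≡⟨ cong (λ z → [ face Δ ρ ]· z) (∑-cong (subsets n) (λ σ → pull (face Δ σ) (ρ ⊆ᵇ σ) (Z σ) (X ρ))) ⟩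
    [ face Δ ρ ]· ∑ₛ n (λ σ → X ρ * ([ face Δ σ ]· [ ρ ⊆ᵇ σ ]· Z σ))
                                                             ≡⟨ cong (λ z → [ face Δ ρ ]· z) (∑-*ˡ (subsets n) (X ρ) _) ⟩
    [ face Δ ρ ]· X ρ * starSum Δ Z ρ                       ∎

module SemiEulerianDuality {n d : ℕ} (Δ : SimplicialComplex n)
  (dim≤d : ∀ ρ → IsFace Δ ρ → ∣ ρ ∣ ≤ d) (semiEulerian : SemiEulerian Δ d) where

  codimSign : Subset n → ℤ
  codimSign σ = sign d * sign ∣ σ ∣

  starSum-nonempty : ∀ ρ → IsFace Δ ρ → 0 ℕ.< ∣ ρ ∣ → starSum Δ codimSign ρ ≡ + 1
  starSum-nonempty ρ ρ∈Δ ρ≢⊥ = begin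
    starSum Δ codimSign ρ
      ≡⟨ ∑-cong (subsets n) (λ σ → []·-comm (face Δ σ) (ρ ⊆ᵇ σ) _) ⟩
    ∑ₛ n (λ σ → [ ρ ⊆ᵇ σ ]· H σ ∣ σ ∣)
      ≡⟨ sym (∑ₛ-disjoint-∪ ρ H) ⟩
    ∑ₛ n (λ τ → [ ∣ τ ∩ ρ ∣ ℕ.≡ᵇ 0 ]· H (τ ∪ ρ) (∣ τ ∣ ℕ.+ ∣ ρ ∣))
      ≡⟨ ∑-cong (subsets n) via-link ⟩
    ∑ₛ n (λ τ → codimSign ρ * ([ link Δ ρ τ ]· sign ∣ τ ∣))
      ≡⟨ ∑-*ˡ (subsets n) (codimSign ρ) _ ⟩
    codimSign ρ * ∑ₛ n (λ τ → [ link Δ ρ τ ]· sign ∣ τ ∣)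
      ≡⟨ cong (codimSign ρ *_) (∑ₛ-sign≡1-eulerChar (link Δ ρ) ⊥∈lk) ⟩
    codimSign ρ * (+ 1 - eulerChar (link Δ ρ))
      ≡⟨ cong₂ (λ s χₗ → s * (+ 1 - χₗ)) (sym (sign-∸ d ∣ ρ ∣ (dim≤d ρ ρ∈Δ))) (semiEulerian ρ ρ∈Δ ρ≢⊥) ⟩
    sign (d ∸ ∣ ρ ∣) * (+ 1 - χSphere (d ∸ ∣ ρ ∣))
      ≡⟨ cong (λ χₛ → sign (d ∸ ∣ ρ ∣) * (+ 1 - χₛ)) (χSphere≡1-sign (d ∸ ∣ ρ ∣)) ⟩
    sign (d ∸ ∣ ρ ∣) * (+ 1 - (+ 1 - sign (d ∸ ∣ ρ ∣)))
      ≡⟨ cong (sign (d ∸ ∣ ρ ∣) *_) (1-[1-x] (sign (d ∸ ∣ ρ ∣))) ⟩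
    sign (d ∸ ∣ ρ ∣) * sign (d ∸ ∣ ρ ∣)
      ≡⟨ sign*sign≡1 (d ∸ ∣ ρ ∣) ⟩
    + 1 ∎
    where
    H : Subset n → ℕ → ℤ
    H σ k = [ face Δ σ ]· sign d * sign k
    ⊥∈lk : link Δ ρ ⊥ ≡ true
    ⊥∈lk rewrite ∩-zeroˡ ρ | ∣⊥∣≡0 n | ∪-identityˡ ρ = ρ∈Δ
    via-link : ∀ τ → [ ∣ τ ∩ ρ ∣ ℕ.≡ᵇ 0 ]· H (τ ∪ ρ) (∣ τ ∣ ℕ.+ ∣ ρ ∣) ≡ codimSign ρ * ([ link Δ ρ τ ]· sign ∣ τ ∣)
    via-link τ with ∣ τ ∩ ρ ∣ ℕ.≡ᵇ 0 | face Δ (τ ∪ ρ)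
    ... | true  | true  = trans (cong (sign d *_) (sign-+ ∣ τ ∣ ∣ ρ ∣)) (reassoc (sign d) (sign ∣ τ ∣) (sign ∣ ρ ∣))
      where
      reassoc : ∀ x y z → x * (y * z) ≡ x * z * y
      reassoc = solve-∀
    ... | true  | false = sym (ℤₚ.*-zeroʳ (codimSign ρ))
    ... | false | _     = sym (ℤₚ.*-zeroʳ (codimSign ρ))
    1-[1-x] : ∀ x → + 1 - (+ 1 - x) ≡ x
    1-[1-x] = solve-∀

  duality : ∀ (X : Subset n → ℤ) →
    faceSum Δ (λ σ → codimSign σ * ∑ₛ n (λ ρ → [ ρ ⊆ᵇ σ ]· X ρ)) ≡ faceSum Δ X + X ⊥ * (starSum Δ codimSign ⊥ - + 1)
  duality X = begin
    faceSum Δ (λ σ → codimSign σ * ∑ₛ n (λ ρ → [ ρ ⊆ᵇ σ ]· X ρ))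
      ≡⟨ faceSum-∑⊆ᵇ-comm Δ X codimSign ⟩
    faceSum Δ (λ ρ → X ρ * E ρ)
      ≡⟨ ∑-cong (subsets n) (λ ρ → split (face Δ ρ) (X ρ) (E ρ)) ⟩
    ∑ₛ n (λ ρ → [ face Δ ρ ]· X ρ + [ face Δ ρ ]· X ρ * (E ρ - + 1))
      ≡⟨ ∑-+ (subsets n) _ _ ⟩
    faceSum Δ X + faceSum Δ (λ ρ → X ρ * (E ρ - + 1))
      ≡⟨ cong (_+_ (faceSum Δ X)) (∑ₛ-at-⊥ n _ vanish) ⟩
    faceSum Δ X + [ face Δ ⊥ ]· X ⊥ * (E ⊥ - + 1)
      ≡⟨ cong (λ b → faceSum Δ X + [ b ]· X ⊥ * (E ⊥ - + 1)) (emptyFace Δ) ⟩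
    faceSum Δ X + X ⊥ * (E ⊥ - + 1) ∎
    where
    E : Subset n → ℤ
    E = starSum Δ codimSign
    split : ∀ b x e → [ b ]· x * e ≡ [ b ]· x + [ b ]· x * (e - + 1)
    split true  x e = x*e≡x+x*[e-1] x e
      where
      x*e≡x+x*[e-1] : ∀ x e → x * e ≡ x + x * (e - + 1)
      x*e≡x+x*[e-1] = solve-∀
    split false x e = refl
    vanish : ∀ ρ → 0 ℕ.< ∣ ρ ∣ → [ face Δ ρ ]· X ρ * (E ρ - + 1) ≡ + 0
    vanish ρ ρ≢⊥ with face Δ ρ in ρ∈Δ
    ... | true  = trans (cong (λ e → X ρ * (e - + 1)) (starSum-nonempty ρ ρ∈Δ ρ≢⊥)) (ℤₚ.*-zeroʳ (X ρ))
    ... | false = refl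

  -- The duality for X ρ = (-1)^|ρ|, whose sums over the subsets of σ vanish unless σ = ∅.
  starSum-⊥ : starSum Δ codimSign ⊥ ≡ χ Δ + sign d
  starSum-⊥ = begin
    E⊥                                           ≡⟨ isolate E⊥ (χ Δ) ⟩
    (+ 1 - χ Δ) + + 1 * (E⊥ - + 1) + χ Δ         ≡⟨ cong (_+ χ Δ) (sym relation) ⟩
    sign d + χ Δ                                 ≡⟨ ℤₚ.+-comm (sign d) (χ Δ) ⟩
    χ Δ + sign d                                 ∎
    where
    E⊥ : ℤ
    E⊥ = starSum Δ codimSign ⊥
    isolate : ∀ e x → e ≡ (+ 1 - x) + + 1 * (e - + 1) + x
    isolate = solve-∀
    vanish : ∀ σ → 0 ℕ.< ∣ σ ∣ → [ face Δ σ ]· codimSign σ * ([ ∣ σ ∣ ℕ.≡ᵇ 0 ]· + 1) ≡ + 0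
    vanish σ σ≢⊥ rewrite ≡ᵇ0-pos σ≢⊥ = trans (cong (λ z → [ face Δ σ ]· z) (ℤₚ.*-zeroʳ (codimSign σ))) ([]·-zero (face Δ σ))
    relation : sign d ≡ (+ 1 - χ Δ) + + 1 * (E⊥ - + 1)
    relation = begin
      sign d
        ≡⟨ sym (trans (ℤₚ.*-identityʳ _) (ℤₚ.*-identityʳ _)) ⟩
      sign d * sign 0 * + 1
        ≡⟨ sym (cong₂ (λ b k → [ b ]· sign d * sign k * ([ k ℕ.≡ᵇ 0 ]· + 1)) (emptyFace Δ) (∣⊥∣≡0 n)) ⟩
      [ face Δ ⊥ ]· codimSign ⊥ * ([ ∣ ⊥ {n} ∣ ℕ.≡ᵇ 0 ]· + 1)
        ≡⟨ sym (∑ₛ-at-⊥ n _ vanish) ⟩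
      faceSum Δ (λ σ → codimSign σ * ([ ∣ σ ∣ ℕ.≡ᵇ 0 ]· + 1))
        ≡⟨ sym (∑-cong (subsets n) (λ σ → cong (λ s → [ face Δ σ ]· codimSign σ * s) (∑ₛ-sign-⊆ᵇ n σ))) ⟩
      faceSum Δ (λ σ → codimSign σ * ∑ₛ n (λ ρ → [ ρ ⊆ᵇ σ ]· sign ∣ ρ ∣))
        ≡⟨ duality (λ ρ → sign ∣ ρ ∣) ⟩
      faceSum Δ (λ ρ → sign ∣ ρ ∣) + sign ∣ ⊥ {n} ∣ * (E⊥ - + 1)
        ≡⟨ cong₂ _+_ (∑ₛ-sign≡1-eulerChar (face Δ) (emptyFace Δ)) (cong (λ k → sign k * (E⊥ - + 1)) (∣⊥∣≡0 n)) ⟩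
      (+ 1 - χ Δ) + + 1 * (E⊥ - + 1) ∎

hProd-complement : ∀ {n m d} {Δ : SimplicialComplex n} {φ : Fin n → Fin m} {a b : Fin m → ℕ} →
  Pure Δ d → ∣ a ∣v ≡ d → Balanced Δ φ a → b ≤v a → ∀ σ → IsFace Δ σ →
  hProd (colorCount φ σ) (λ j → a j ∸ colorCount φ σ j) (λ j → a j ∸ b j)
    ≡ sign d * sign ∣ σ ∣ * ∑ₛ n (λ ρ → [ ρ ⊆ᵇ σ ]· hProd (colorCount φ ρ) (λ j → a j ∸ colorCount φ ρ j) b)
hProd-complement {n} {d = d} {Δ} {φ} {a} {b} pure ∣a∣≡d balanced b≤a σ σ∈Δ = begin
  hProd (colorCount φ σ) (λ j → a j ∸ colorCount φ σ j) (λ j → a j ∸ b j)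
    ≡⟨ hProd-reverse a (colorCount φ σ) b σ≤a b≤a ⟩
  sign ∣ a ∣v * sign ∣ colorCount φ σ ∣v * hProd (λ _ → 0) (λ j → a j ∸ colorCount φ σ j) b
    ≡⟨ cong₂ (λ k l → sign k * sign l * hProd (λ _ → 0) (λ j → a j ∸ colorCount φ σ j) b) ∣a∣≡d (∣colorCount∣v n φ σ) ⟩
  sign d * sign ∣ σ ∣ * hProd (λ _ → 0) (λ j → a j ∸ colorCount φ σ j) b
    ≡⟨ cong (sign d * sign ∣ σ ∣ *_) (sym (∑ₛ-⊆ᵇ-hProd n φ σ (λ _ → 0) a b σ≤a)) ⟩
  sign d * sign ∣ σ ∣ * ∑ₛ n (λ ρ → [ ρ ⊆ᵇ σ ]· hProd (colorCount φ ρ) (λ j → a j ∸ colorCount φ ρ j) b) ∎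
  where
  σ≤a : ∀ j → colorCount φ σ j ≤ a j
  σ≤a = colorCount≤ {Δ = Δ} pure balanced σ∈Δ

theorem3p8 : ∀ {n m d : ℕ} (Δ : SimplicialComplex n) (φ : Fin n → Fin m) (a : Fin m → ℕ) →
    4 ≤ d → Connected Δ → Pure Δ d → SemiEulerian Δ d →
    (∀ j → 1 ≤ a j) → ∣ a ∣v ≡ d → Balanced Δ φ a →
    ∀ (b : Fin m → ℕ) → b ≤v a →
    fineH Δ φ a (λ j → a j ∸ b j) - fineH Δ φ a b
      ≡ sign ∣ b ∣v * (χ Δ - χSphere d) * prodℤ m (λ j → + (a j C b j))
theorem3p8 {n} {m} {d} Δ φ a _ _ pure semiEulerian _ ∣a∣≡d balanced b b≤a = begin
  fineH Δ φ a (λ j → a j ∸ b j) - fineH Δ φ a b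
    ≡⟨ cong (_- fineH Δ φ a b) reflection ⟩
  fineH Δ φ a b + X ⊥ * (χ Δ + sign d - + 1) - fineH Δ φ a b
    ≡⟨ cong (λ x → fineH Δ φ a b + x * (χ Δ + sign d - + 1) - fineH Δ φ a b) X⊥ ⟩
  fineH Δ φ a b + sign ∣ b ∣v * binomials * (χ Δ + sign d - + 1) - fineH Δ φ a b
    ≡⟨ rearrange (fineH Δ φ a b) (sign ∣ b ∣v) binomials (χ Δ) (sign d) ⟩
  sign ∣ b ∣v * (χ Δ - (+ 1 - sign d)) * binomials
    ≡⟨ cong (λ s → sign ∣ b ∣v * (χ Δ - s) * binomials) (sym (χSphere≡1-sign d)) ⟩
  sign ∣ b ∣v * (χ Δ - χSphere d) * binomials ∎
  where
  open SemiEulerianDuality Δ (proj₁ pure) semiEulerian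
  binomials : ℤ
  binomials = prodℤ m (λ j → + (a j C b j))
  X : Subset n → ℤ
  X ρ = hProd (colorCount φ ρ) (λ j → a j ∸ colorCount φ ρ j) b
  X⊥ : X ⊥ ≡ sign ∣ b ∣v * binomials
  X⊥ = trans (prodℤ-cong m (λ j → cong (λ c → hTerm c (a j ∸ c) (b j)) (colorCount-⊥ φ j))) (hProd-zero a b)
  reflection : fineH Δ φ a (λ j → a j ∸ b j) ≡ fineH Δ φ a b + X ⊥ * (χ Δ + sign d - + 1)
  reflection = begin
    fineH Δ φ a (λ j → a j ∸ b j)
      ≡⟨ fineH≡faceSum Δ φ a _ ⟩
    faceSum Δ (λ σ → hProd (colorCount φ σ) (λ j → a j ∸ colorCount φ σ j) (λ j → a j ∸ b j))
      ≡⟨ faceSum-cong Δ (hProd-complement {Δ = Δ} pure ∣a∣≡d balanced b≤a) ⟩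
    faceSum Δ (λ σ → codimSign σ * ∑ₛ n (λ ρ → [ ρ ⊆ᵇ σ ]· X ρ))
      ≡⟨ duality X ⟩
    faceSum Δ X + X ⊥ * (starSum Δ codimSign ⊥ - + 1)
      ≡⟨ cong₂ (λ h e → h + X ⊥ * (e - + 1)) (sym (fineH≡faceSum Δ φ a b)) starSum-⊥ ⟩
    fineH Δ φ a b + X ⊥ * (χ Δ + sign d - + 1) ∎
  rearrange : ∀ h s p c e → h + s * p * (c + e - + 1) - h ≡ s * (c - (+ 1 - e)) * p
  rearrange = solve-∀
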